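{- Consider the online matroid intersection market defined below. Let $i^{\mathrm{inc}}$ be an incoming buyer, and let $p^{\mathrm{old}}$ and $p^{\mathrm{new}}$ be the canonical price vectors for the instances immediately before and after its arrival. Then $p^{\mathrm{new}}_e\ge p^{\mathrm{old}}_e$ for every element $e\in E$. Moreover, let $q:=\min_{e\in P_{i^{\mathrm{inc}}}}p^{\mathrm{old}}_e$. Then every $e$ with $p^{\mathrm{old}}_e<q$ satisfies $p^{\mathrm{new}}_e=p^{\mathrm{old}}_e$.
   Context: Let $\mathcal{M}$ be a matroid on a finite set $E$ with rank function $\mathrm{rank}$. Let $P_i$, $i\in B$, partition $E$, one part per buyer. Buyers arrive over time: every buyer that has arrived has budget $m_i=1$, and every buyer not yet arrived has $m_i=0$. The arrival of $i^{\mathrm{inc}}$ changes its budget from $0$ to $1$ and leaves all other budgets unchanged. For $B'\subseteq B$ write $m(B')=\sum_{i\in B'}m_i$ and $N(B')=\bigcup_{i\in B'}P_i$. For $F\subseteq E$: - $\mathrm{rank}_{\mathcal{M}/F}(X)=\mathrm{rank}(X\cup F)-\mathrm{rank}(F)$; - $\mathrm{Span}_{\mathcal{M}/F}(X)$ is the set of $e\in E\setminus F$ not increasing this rank when added to $X$; - $\mathcal{M}_\ell=\mathcal{M}/E_\ell$ and $\mathrm{InvExp}^{(\ell)}(B')=m(B')/\mathrm{rank}_{\mathcal{M}_\ell}(N(B')\setminus E_\ell)$. Canonical prices for given budgets are produced by the MI skeleton algorithm. Set $E_0=\emptyset$ and $B^{\mathrm{rem}}_0=B$. For $\ell=0,1,\dots$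 while $B^{\mathrm{rem}}_\ell\ne\emptyset$: 1. Let $\rho=\max_{B'\subseteq B^{\mathrm{rem}}_\ell}\mathrm{InvExp}^{(\ell)}(B')$. 2. Let $B_{\ell+1}$ be the unique inclusion-wise largest set attaining $\rho$. 3. Assign price $\rho$ to every $e\in S':=\mathrm{Span}_{\mathcal{M}_\ell}(N(B_{\ell+1})\setminus E_\ell)$. 4. Set $E_{\ell+1}=E_\ell\cup S'$ and $B^{\mathrm{rem}}_{\ell+1}=B^{\mathrm{rem}}_\ell\setminus B_{\ell+1}$. These prices arise from an optimal dual solution of $\max\sum_i m_i\log(\sum_{e\in P_i}y_e)$ s.t. $\sum_{e\in S}y_e\le\mathrm{rank}(S)$ for all $S\subseteq E$, $y\ge0$, via $p_e=\sum_{S\ni e}\alpha_S$. -}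

module Defs where

open import Data.Nat using (ℕ; zero; suc; _+_; _∸_; _≤_; _≟_)
open import Data.Bool using (Bool; true; false; _∧_; not)
open import Data.Fin using (Fin)
open import Data.Fin.Subset using (Subset; _∪_; _∩_; _─_; _⊆_; _∈_; ∣_∣; ⊥; ⊤; ⁅_⁆)
open import Data.Vec using (lookup; tabulate)
open import Data.Integer using (+_)
open import Data.Rational using (ℚ; 0ℚ; _/_) renaming (_≤_ to _≤ℚ_)
open import Relation.Nullary.Decidable using (⌊_⌋)
open import Relation.Binary.PropositionalEquality using (_≡_)

record Matroid (n : ℕ) : Set where
  field
    rank        : Subset n → ℕ
    rank-bound  : ∀ X → rank X ≤ ∣ X ∣
    rank-mono   : ∀ {X Y} → X ⊆ Y → rank X ≤ rank Y
    rank-submod : ∀ X Y → rank (X ∪ Y) + rank (X ∩ Y) ≤ rank X + rank Y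

open Matroid public

module Market {n k : ℕ} (M : Matroid n) (owner : Fin n → Fin k) where
  -- The partition P_i, i ∈ B = Fin k, is given by e ∈ P_(owner e).

  N : Subset k → Subset n
  N B' = tabulate (λ e → lookup B' (owner e))

  P : Fin k → Subset n
  P i = N ⁅ i ⁆

  rankC : Subset n → Subset n → ℕ
  rankC F X = rank M (X ∪ F) ∸ rank M F

  SpanC : Subset n → Subset n → Subset n
  SpanC F X = tabulate (λ e → not (lookup F e) ∧ ⌊ rankC F (X ∪ ⁅ e ⁆) ≟ rankC F X ⌋)

  -- a / b as a rational; convention 0/0 := 0 (only arises for B' = ∅).
  ratio : ℕ → ℕ → ℚ
  ratio a zero    = 0ℚ
  ratio a (suc b) = (+ a) / suc b

  -- Budgets: m_i = 1 iff i ∈ A (the set of arrived buyers), so m(B') = |B' ∩ A|.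
  -- InvExp^(ℓ)(B') = m(B') / rank_{M_ℓ}(N(B') ∖ E_ℓ), with M_ℓ = M / E_ℓ.
  InvExp : Subset k → Subset n → Subset k → ℚ
  InvExp A Eℓ B' = ratio ∣ B' ∩ A ∣ (rankC Eℓ (N B' ─ Eℓ))

  -- Runs of the MI skeleton algorithm from state (E_ℓ, B^rem_ℓ); a run
  -- certifies that the price vector p agrees with the prices it assigns.
  data Run (A : Subset k) (p : Fin n → ℚ) : Subset n → Subset k → Set where
    done : ∀ {Eℓ} → Run A p Eℓ ⊥
    step : ∀ {Eℓ Brem} (ρ : ℚ) (Bnext : Subset k) →
      (∀ B' → B' ⊆ Brem → InvExp A Eℓ B' ≤ℚ ρ) →
      Bnext ⊆ Brem →
      InvExp A Eℓ Bnext ≡ ρ →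
      (∀ B' → B' ⊆ Brem → InvExp A Eℓ B' ≡ ρ → B' ⊆ Bnext) →
      (∀ e → e ∈ SpanC Eℓ (N Bnext ─ Eℓ) → p e ≡ ρ) →
      Run A p (Eℓ ∪ SpanC Eℓ (N Bnext ─ Eℓ)) (Brem ─ Bnext) →
      Run A p Eℓ Brem

  Canonical : Subset k → (Fin n → ℚ) → Set
  Canonical A p = Run A p ⊥ ⊤

{-# OPTIONS --safe #-}
module Submission where

-- For a threshold l > 0 consider surplus l X = m(X) − l·rank(N(X)) on sets X of buyers; it is
-- supermodular, since m is modular and X ↦ rank(N(X)) is submodular.  Following the skeleton
-- algorithm until its ratio drops below l shows that the level set {e | l ≤ p e} is spanned by
-- N(C), where C is a maximiser of surplus l that is largest in rank, and is a flat (or empty).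
-- The arrival of i^inc adds the monotone modular term |X ∩ {i^inc}| to the surplus.  Hence the
-- union of the old and the new maximiser maximises the new surplus, so the old level set lies
-- in the new one: prices do not decrease.  Below q all of P_{i^inc} is already in the old level
-- set, so adding i^inc to the old maximiser raises the new surplus by exactly one; as the new
-- term is at most one, the new maximiser also maximises the old surplus, the new level set lies
-- in the old one, and no price below q rises.

open import Defs
open import Data.Nat using (ℕ; zero; suc; _+_; _∸_; _≤_; z≤n; s≤s; _≟_)
import Data.Nat.Properties as ℕₚ
import Data.Integer as ℤ
import Data.Integer.Properties as ℤₚ
open import Data.Integer.GCD using (gcd)
open import Data.Nat.Coprimality as Coprime using (1-coprimeTo)
open import Data.Rational as ℚ using (ℚ; _<_; 0ℚ; mkℚ; _/_; ↥_; ↧_; *≤*; *<*) renaming (_≤_ to _≤ℚ_)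
import Data.Rational.Properties as ℚₚ
open import Data.Rational.Unnormalised using (*≡*)
import Data.Rational.Unnormalised.Properties as ℚᵘₚ
open import Algebra.Properties.Group ℚₚ.+-0-group using (identityʳ-unique; x∙y⁻¹≈ε⇒x≈y)
open import Data.Fin using (Fin)
open import Data.Fin.Subset using (Subset; inside; outside; _∪_; _∩_; _─_; _⊆_; _∈_; _∉_; ⁅_⁆; ⊥; ⊤; ∣_∣; Empty; ⋃)
open import Data.Fin.Subset.Properties
open import Data.Bool using (Bool; true; false; not; _∧_)
open import Data.Vec using ([]; _∷_; here; there; lookup; tabulate)
open import Data.Vec.Properties using ([]=⇒lookup; lookup⇒[]=; lookup∘tabulate)
open import Data.List as List using (map; filter; allFin)
open import Data.List.Relation.Unary.Any as Any using ()
open import Data.List.Membership.Propositional using () renaming (_∈_ to _∈ₗ_)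
open import Data.List.Membership.Propositional.Properties using (∈-filter⁺; ∈-filter⁻; ∈-allFin)
open import Function using (_∘_)
open import Data.Product using (_×_; ∃; _,_; proj₁; proj₂)
open import Data.Sum using (_⊎_; inj₁; inj₂; [_,_]′)
open import Relation.Binary.PropositionalEquality
open import Relation.Nullary using (¬_; Dec; yes; no; contradiction)
open import Relation.Nullary.Decidable using (⌊_⌋)

fromℕ : ℕ → ℚ
fromℕ n = mkℚ (ℤ.+ n) 0 (Coprime.sym (1-coprimeTo n))

fromℕ-+ : ∀ a b → fromℕ (a + b) ≡ fromℕ a ℚ.+ fromℕ b
fromℕ-+ a b = ℚₚ.toℚᵘ-injective
  (ℚᵘₚ.≃-trans (*≡* numerators) (ℚᵘₚ.≃-sym (ℚₚ.toℚᵘ-homo-+ (fromℕ a) (fromℕ b))))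
  where
  open ≡-Reasoning
  numerators : ℤ.+ (a + b) ℤ.* ℤ.1ℤ ≡ (ℤ.+ a ℤ.* ℤ.1ℤ ℤ.+ ℤ.+ b ℤ.* ℤ.1ℤ) ℤ.* ℤ.1ℤ
  numerators = begin
    ℤ.+ (a + b) ℤ.* ℤ.1ℤ                          ≡⟨ ℤₚ.*-identityʳ _ ⟩
    ℤ.+ (a + b)                                   ≡⟨ ℤₚ.pos-+ a b ⟩
    ℤ.+ a ℤ.+ ℤ.+ b                               ≡⟨ cong₂ ℤ._+_ (ℤₚ.*-identityʳ (ℤ.+ a)) (ℤₚ.*-identityʳ (ℤ.+ b)) ⟨
    ℤ.+ a ℤ.* ℤ.1ℤ ℤ.+ ℤ.+ b ℤ.* ℤ.1ℤ             ≡⟨ ℤₚ.*-identityʳ _ ⟨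
    (ℤ.+ a ℤ.* ℤ.1ℤ ℤ.+ ℤ.+ b ℤ.* ℤ.1ℤ) ℤ.* ℤ.1ℤ ∎

fromℕ-mono-≤ : ∀ {a b} → a ≤ b → fromℕ a ≤ℚ fromℕ b
fromℕ-mono-≤ {a} {b} a≤b =
  *≤* (subst₂ ℤ._≤_ (sym (ℤₚ.*-identityʳ (ℤ.+ a))) (sym (ℤₚ.*-identityʳ (ℤ.+ b))) (ℤ.+≤+ a≤b))

fromℕ-cancel-≤ : ∀ {a b} → fromℕ a ≤ℚ fromℕ b → a ≤ b
fromℕ-cancel-≤ {a} {b} a≤b =
  ℤₚ.drop‿+≤+ (subst₂ ℤ._≤_ (ℤₚ.*-identityʳ (ℤ.+ a)) (ℤₚ.*-identityʳ (ℤ.+ b)) (ℚₚ.drop-*≤* a≤b))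

0≤fromℕ : ∀ a → 0ℚ ≤ℚ fromℕ a
0≤fromℕ a = fromℕ-mono-≤ z≤n

0<fromℕ-suc : ∀ b → 0ℚ < fromℕ (suc b)
0<fromℕ-suc b = *<* (subst (ℤ._<_ ℤ.0ℤ) (sym (ℤₚ.*-identityʳ (ℤ.+ suc b))) (ℤ.+<+ (s≤s z≤n)))

*-cancelʳ-≤-fromℕ-suc : ∀ {p q} b → p ℚ.* fromℕ (suc b) ≤ℚ q ℚ.* fromℕ (suc b) → p ≤ℚ q
*-cancelʳ-≤-fromℕ-suc b = ℚₚ.*-cancelʳ-≤-pos (fromℕ (suc b)) {{ℚ.positive (0<fromℕ-suc b)}}

/-*-denominator : ∀ a b → (ℤ.+ a / suc b) ℚ.* fromℕ (suc b) ≡ fromℕ a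
/-*-denominator a b = lemma (ℤ.+ a / suc b) (ℚₚ.↥-/ (ℤ.+ a) (suc b)) (ℚₚ.↧-/ (ℤ.+ a) (suc b))
  where
  g = gcd (ℤ.+ a) (ℤ.+ suc b)
  lemma : ∀ p → ↥ p ℤ.* g ≡ ℤ.+ a → ↧ p ℤ.* g ≡ ℤ.+ suc b → p ℚ.* fromℕ (suc b) ≡ fromℕ a
  lemma p@(mkℚ _ _ _) ↥p*g≡a ↧p*g≡1+b =
    ℚₚ.toℚᵘ-injective (ℚᵘₚ.≃-trans (ℚₚ.toℚᵘ-homo-* p (fromℕ (suc b))) (*≡* cross))
    where
    open ≡-Reasoning
    import Data.Integer.Solver as ℤSolver
    open ℤSolver.+-*-Solver
    cross : (↥ p ℤ.* ℤ.+ suc b) ℤ.* ℤ.1ℤ ≡ ℤ.+ a ℤ.* (↧ p ℤ.* ℤ.1ℤ)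
    cross = begin
      (↥ p ℤ.* ℤ.+ suc b) ℤ.* ℤ.1ℤ  ≡⟨ ℤₚ.*-identityʳ _ ⟩
      ↥ p ℤ.* ℤ.+ suc b             ≡⟨ cong (↥ p ℤ.*_) (sym ↧p*g≡1+b) ⟩
      ↥ p ℤ.* (↧ p ℤ.* g)           ≡⟨ solve 3 (λ x y z → x :* (y :* z) := (x :* z) :* y) refl (↥ p) (↧ p) g ⟩
      (↥ p ℤ.* g) ℤ.* ↧ p           ≡⟨ cong (ℤ._* ↧ p) ↥p*g≡a ⟩
      ℤ.+ a ℤ.* ↧ p                 ≡⟨ cong (ℤ.+ a ℤ.*_) (sym (ℤₚ.*-identityʳ (↧ p))) ⟩
      ℤ.+ a ℤ.* (↧ p ℤ.* ℤ.1ℤ)      ∎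

p≤q⇒0≤q-p : ∀ {p q} → p ≤ℚ q → 0ℚ ≤ℚ q ℚ.- p
p≤q⇒0≤q-p {p} {q} p≤q = subst (_≤ℚ q ℚ.- p) (ℚₚ.+-inverseʳ p) (ℚₚ.+-monoˡ-≤ (ℚ.- p) p≤q)

p≤q⇒p-q≤0 : ∀ {p q} → p ≤ℚ q → p ℚ.- q ≤ℚ 0ℚ
p≤q⇒p-q≤0 {p} {q} p≤q = subst (p ℚ.- q ≤ℚ_) (ℚₚ.+-inverseʳ q) (ℚₚ.+-monoˡ-≤ (ℚ.- q) p≤q)

+-cancelʳ-≤ : ∀ r {p q} → p ℚ.+ r ≤ℚ q ℚ.+ r → p ≤ℚ q
+-cancelʳ-≤ r {p} {q} p+r≤q+r =
  subst₂ _≤ℚ_ (cancel p) (cancel q) (ℚₚ.+-monoˡ-≤ (ℚ.- r) p+r≤q+r)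
  where
  open import Data.Rational.Solver
  open +-*-Solver
  cancel : ∀ x → x ℚ.+ r ℚ.- r ≡ x
  cancel x = solve 2 (λ x r → x :+ r :- r := x) refl x r

*-monoʳ-≤-fromℕ : ∀ u {p q} → p ≤ℚ q → p ℚ.* fromℕ u ≤ℚ q ℚ.* fromℕ u
*-monoʳ-≤-fromℕ u = ℚₚ.*-monoʳ-≤-nonNeg (fromℕ u) {{ℚ.nonNegative (0≤fromℕ u)}}

p+q≤r+s∧s≤q⇒p≤r : ∀ {p q r s} → p ℚ.+ q ≤ℚ r ℚ.+ s → s ≤ℚ q → p ≤ℚ r
p+q≤r+s∧s≤q⇒p≤r {q = q} {r} p+q≤r+s s≤q = +-cancelʳ-≤ q (ℚₚ.≤-trans p+q≤r+s (ℚₚ.+-monoʳ-≤ r s≤q))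

<⇒≱ : ∀ {p q} → p < q → ¬ (q ≤ℚ p)
<⇒≱ p<q q≤p = ℚₚ.<-irrefl refl (ℚₚ.<-≤-trans p<q q≤p)

<-dense-≤ : ∀ {p q r} → p < q → p < r → ∃ λ μ → p < μ × μ < q × μ ≤ℚ r
<-dense-≤ {p} {q} {r} p<q p<r with q ℚₚ.≤? r
... | yes q≤r = let (μ , p<μ , μ<q) = ℚₚ.<-dense p<q in μ , p<μ , μ<q , ℚₚ.≤-trans (ℚₚ.<⇒≤ μ<q) q≤r
... | no  q≰r = let (μ , p<μ , μ<r) = ℚₚ.<-dense p<r in μ , p<μ , ℚₚ.<-trans μ<r (ℚₚ.≰⇒> q≰r) , ℚₚ.<⇒≤ μ<r

excess : ℚ → ℕ → ℕ → ℚ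
excess l a u = fromℕ a ℚ.- l ℚ.* fromℕ u

excess-+ : ∀ l a₁ a₂ u₁ u₂ → excess l (a₁ + a₂) (u₁ + u₂) ≡ excess l a₁ u₁ ℚ.+ excess l a₂ u₂
excess-+ l a₁ a₂ u₁ u₂ rewrite fromℕ-+ a₁ a₂ | fromℕ-+ u₁ u₂ =
  solve 5 (λ a₁ a₂ u₁ u₂ l → (a₁ :+ a₂) :- l :* (u₁ :+ u₂) := (a₁ :- l :* u₁) :+ (a₂ :- l :* u₂))
    refl (fromℕ a₁) (fromℕ a₂) (fromℕ u₁) (fromℕ u₂) l
  where open import Data.Rational.Solver
        open +-*-Solver

excess-+ˡ : ∀ l a b u → excess l (a + b) u ≡ excess l a u ℚ.+ fromℕ b
excess-+ˡ l a b u rewrite fromℕ-+ a b =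
  solve 4 (λ a b u l → (a :+ b) :- l :* u := (a :- l :* u) :+ b) refl (fromℕ a) (fromℕ b) (fromℕ u) l
  where open import Data.Rational.Solver
        open +-*-Solver

excess-antitone : ∀ {l} a {u v} → 0ℚ ≤ℚ l → u ≤ v → excess l a v ≤ℚ excess l a u
excess-antitone {l} a 0≤l u≤v = ℚₚ.+-monoʳ-≤ (fromℕ a)
  (ℚₚ.neg-antimono-≤ (ℚₚ.*-monoˡ-≤-nonNeg l {{ℚ.nonNegative 0≤l}} (fromℕ-mono-≤ u≤v)))

excess-nonPos : ∀ {l ρ a u} → fromℕ a ≤ℚ ρ ℚ.* fromℕ u → ρ ≤ℚ l → excess l a u ≤ℚ 0ℚ
excess-nonPos {u = u} a≤ρu ρ≤l = p≤q⇒p-q≤0 (ℚₚ.≤-trans a≤ρu (*-monoʳ-≤-fromℕ u ρ≤l))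

excess-mono : ∀ {l ρ a b u v} → fromℕ a ≤ℚ ρ ℚ.* fromℕ u → fromℕ b ≡ ρ ℚ.* fromℕ v →
              u ≤ v → l ≤ℚ ρ → excess l a u ≤ℚ excess l b v
excess-mono {l} {ρ} {a} {b} {u} {v} a≤ρu b≡ρv u≤v l≤ρ = begin
  fromℕ a ℚ.- l ℚ.* fromℕ u          ≤⟨ ℚₚ.+-monoˡ-≤ (ℚ.- (l ℚ.* fromℕ u)) a≤ρu ⟩
  ρ ℚ.* fromℕ u ℚ.- l ℚ.* fromℕ u    ≡⟨ factor u ⟩
  (ρ ℚ.- l) ℚ.* fromℕ u              ≤⟨ ℚₚ.*-monoˡ-≤-nonNeg (ρ ℚ.- l) {{ℚ.nonNegative (p≤q⇒0≤q-p l≤ρ)}}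
                                                              (fromℕ-mono-≤ u≤v) ⟩
  (ρ ℚ.- l) ℚ.* fromℕ v              ≡⟨ sym (factor v) ⟩
  ρ ℚ.* fromℕ v ℚ.- l ℚ.* fromℕ v    ≡⟨ cong (ℚ._- l ℚ.* fromℕ v) (sym b≡ρv) ⟩
  fromℕ b ℚ.- l ℚ.* fromℕ v          ∎
  where
  open ℚₚ.≤-Reasoning
  open import Data.Rational.Solver
  open +-*-Solver
  factor : ∀ w → ρ ℚ.* fromℕ w ℚ.- l ℚ.* fromℕ w ≡ (ρ ℚ.- l) ℚ.* fromℕ w
  factor w = solve 3 (λ ρ l w → ρ :* w :- l :* w := (ρ :- l) :* w) refl ρ l (fromℕ w)

excess≡0⇒≡0 : ∀ {l ρ a} d → excess l a d ≡ 0ℚ → fromℕ a ≤ℚ ρ ℚ.* fromℕ d → ρ < l → d ≡ 0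
excess≡0⇒≡0 zero    _ _ _ = refl
excess≡0⇒≡0 {l} {ρ} {a} (suc d) excess≡0 a≤ρd ρ<l =
  contradiction (*-cancelʳ-≤-fromℕ-suc d (subst (_≤ℚ ρ ℚ.* fromℕ (suc d)) a≡ld a≤ρd)) (<⇒≱ ρ<l)
  where
  a≡ld : fromℕ a ≡ l ℚ.* fromℕ (suc d)
  a≡ld = x∙y⁻¹≈ε⇒x≈y (fromℕ a) (l ℚ.* fromℕ (suc d)) excess≡0

a+b≤ρ[u+v]∧b≡ρv⇒a≤ρu : ∀ {ρ a b u v} → fromℕ (a + b) ≤ℚ ρ ℚ.* fromℕ (u + v) → fromℕ b ≡ ρ ℚ.* fromℕ v →
                        fromℕ a ≤ℚ ρ ℚ.* fromℕ u
a+b≤ρ[u+v]∧b≡ρv⇒a≤ρu {ρ} {a} {b} {u} {v} a+b≤ρ[u+v] b≡ρv = begin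
  fromℕ a                                        ≡⟨ solve 2 (λ a b → a := (a :+ b) :- b) refl (fromℕ a) (fromℕ b) ⟩
  fromℕ a ℚ.+ fromℕ b ℚ.- fromℕ b                ≡⟨ cong (ℚ._- fromℕ b) (sym (fromℕ-+ a b)) ⟩
  fromℕ (a + b) ℚ.- fromℕ b                      ≤⟨ ℚₚ.+-monoˡ-≤ (ℚ.- fromℕ b) a+b≤ρ[u+v] ⟩
  ρ ℚ.* fromℕ (u + v) ℚ.- fromℕ b                ≡⟨ cong₂ (λ x y → ρ ℚ.* x ℚ.- y) (fromℕ-+ u v) b≡ρv ⟩
  ρ ℚ.* (fromℕ u ℚ.+ fromℕ v) ℚ.- ρ ℚ.* fromℕ v  ≡⟨ solve 3 (λ ρ u v → ρ :* (u :+ v) :- ρ :* v := ρ :* u)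
                                                          refl ρ (fromℕ u) (fromℕ v) ⟩
  ρ ℚ.* fromℕ u                                  ∎
  where
  open ℚₚ.≤-Reasoning
  open import Data.Rational.Solver
  open +-*-Solver

x∈p─q⇒x∉q : ∀ {n} {x : Fin n} (p q : Subset n) → x ∈ p ─ q → x ∉ q
x∈p─q⇒x∉q (_ ∷ p) (inside  ∷ q) (there x∈p─q) (there x∈q) = x∈p─q⇒x∉q p q x∈p─q x∈q
x∈p─q⇒x∉q (_ ∷ p) (outside ∷ q) (there x∈p─q) (there x∈q) = x∈p─q⇒x∉q p q x∈p─q x∈q

∪-⊆ : ∀ {n} {p q r : Subset n} → p ⊆ r → q ⊆ r → p ∪ q ⊆ r
∪-⊆ {p = p} {q} p⊆r q⊆r x∈p∪q = [ p⊆r , q⊆r ]′ (x∈p∪q⁻ p q x∈p∪q)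

p⊆q∪[p─q] : ∀ {n} (p q : Subset n) → p ⊆ q ∪ (p ─ q)
p⊆q∪[p─q] p q {x} x∈p with x ∈? q
... | yes x∈q = p⊆p∪q (p ─ q) x∈q
... | no  x∉q = q⊆p∪q q (p ─ q) (x∈p∧x∉q⇒x∈p─q x∈p x∉q)

∣p∪q∣+∣p∩q∣≡∣p∣+∣q∣ : ∀ {n} (p q : Subset n) → ∣ p ∪ q ∣ + ∣ p ∩ q ∣ ≡ ∣ p ∣ + ∣ q ∣
∣p∪q∣+∣p∩q∣≡∣p∣+∣q∣ []            []            = refl
∣p∪q∣+∣p∩q∣≡∣p∣+∣q∣ (inside  ∷ p) (inside  ∷ q) = cong suc (begin
  ∣ p ∪ q ∣ + suc ∣ p ∩ q ∣    ≡⟨ ℕₚ.+-suc _ _ ⟩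
  suc (∣ p ∪ q ∣ + ∣ p ∩ q ∣)  ≡⟨ cong suc (∣p∪q∣+∣p∩q∣≡∣p∣+∣q∣ p q) ⟩
  suc (∣ p ∣ + ∣ q ∣)          ≡⟨ ℕₚ.+-suc _ _ ⟨
  ∣ p ∣ + suc ∣ q ∣            ∎)
  where open ≡-Reasoning
∣p∪q∣+∣p∩q∣≡∣p∣+∣q∣ (inside  ∷ p) (outside ∷ q) = cong suc (∣p∪q∣+∣p∩q∣≡∣p∣+∣q∣ p q)
∣p∪q∣+∣p∩q∣≡∣p∣+∣q∣ (outside ∷ p) (inside  ∷ q) =
  trans (cong suc (∣p∪q∣+∣p∩q∣≡∣p∣+∣q∣ p q)) (sym (ℕₚ.+-suc _ _))
∣p∪q∣+∣p∩q∣≡∣p∣+∣q∣ (outside ∷ p) (outside ∷ q) = ∣p∪q∣+∣p∩q∣≡∣p∣+∣q∣ p q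

Empty⇒∣p∣≡0 : ∀ {n} {p : Subset n} → Empty p → ∣ p ∣ ≡ 0
Empty⇒∣p∣≡0 {n} empty = trans (cong ∣_∣ (Empty-unique empty)) (∣⊥∣≡0 n)

∣p∪q∣≡∣p∣+∣q∣ : ∀ {n} (p q : Subset n) → Empty (p ∩ q) → ∣ p ∪ q ∣ ≡ ∣ p ∣ + ∣ q ∣
∣p∪q∣≡∣p∣+∣q∣ p q disjoint = begin
  ∣ p ∪ q ∣             ≡⟨ ℕₚ.+-identityʳ _ ⟨
  ∣ p ∪ q ∣ + 0         ≡⟨ cong (∣ p ∪ q ∣ +_) (Empty⇒∣p∣≡0 disjoint) ⟨
  ∣ p ∪ q ∣ + ∣ p ∩ q ∣ ≡⟨ ∣p∪q∣+∣p∩q∣≡∣p∣+∣q∣ p q ⟩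
  ∣ p ∣ + ∣ q ∣         ∎
  where open ≡-Reasoning

∪-monoˡ-⊆ : ∀ {n} {p q : Subset n} r → p ⊆ q → p ∪ r ⊆ q ∪ r
∪-monoˡ-⊆ {q = q} r p⊆q = ∪-⊆ (⊆-trans p⊆q (p⊆p∪q r)) (q⊆p∪q q r)

∪-monoʳ-⊆ : ∀ {n} {q r : Subset n} p → q ⊆ r → p ∪ q ⊆ p ∪ r
∪-monoʳ-⊆ {r = r} p q⊆r = ∪-⊆ (p⊆p∪q r) (⊆-trans q⊆r (q⊆p∪q p r))

p∪[q─p]≡p∪q : ∀ {n} (p q : Subset n) → p ∪ (q ─ p) ≡ p ∪ q
p∪[q─p]≡p∪q p q = ⊆-antisym (∪-monoʳ-⊆ p (p─q⊆p q p)) (∪-⊆ (p⊆p∪q (q ─ p)) (p⊆q∪[p─q] q p))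

p⊆q⇒p∪q≡q : ∀ {n} {p q : Subset n} → p ⊆ q → p ∪ q ≡ q
p⊆q⇒p∪q≡q {p = p} {q} p⊆q = ⊆-antisym (∪-⊆ p⊆q ⊆-refl) (q⊆p∪q p q)

x∈p∪q∧x∉p⇒x∈q : ∀ {n} {x : Fin n} {p q : Subset n} → x ∈ p ∪ q → x ∉ p → x ∈ q
x∈p∪q∧x∉p⇒x∈q {p = p} {q} x∈p∪q x∉p = [ (λ x∈p → contradiction x∈p x∉p) , (λ x∈q → x∈q) ]′ (x∈p∪q⁻ p q x∈p∪q)

∩-monoˡ-⊆ : ∀ {n} {p q : Subset n} r → p ⊆ q → p ∩ r ⊆ q ∩ r
∩-monoˡ-⊆ {p = p} r p⊆q x∈p∩r = let (x∈p , x∈r) = x∈p∩q⁻ p r x∈p∩r in x∈p∩q⁺ (p⊆q x∈p , x∈r)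

x∉p∧x∉q⇒x∉p∪q : ∀ {n} {x : Fin n} {p q : Subset n} → x ∉ p → x ∉ q → x ∉ p ∪ q
x∉p∧x∉q⇒x∉p∪q {p = p} {q} x∉p x∉q x∈p∪q = [ x∉p , x∉q ]′ (x∈p∪q⁻ p q x∈p∪q)

x∈p⇒⁅x⁆⊆p : ∀ {n} {x : Fin n} {p : Subset n} → x ∈ p → ⁅ x ⁆ ⊆ p
x∈p⇒⁅x⁆⊆p {x = x} {p} x∈p y∈⁅x⁆ = subst (_∈ p) (sym (x∈⁅y⁆⇒x≡y x y∈⁅x⁆)) x∈p

∈-tabulate⁺ : ∀ {n} {f : Fin n → Bool} {x} → f x ≡ true → x ∈ tabulate f
∈-tabulate⁺ {f = f} {x} fx≡true = lookup⇒[]= x (tabulate f) (trans (lookup∘tabulate f x) fx≡true)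

∈-tabulate⁻ : ∀ {n} {f : Fin n → Bool} {x} → x ∈ tabulate f → f x ≡ true
∈-tabulate⁻ {f = f} {x} x∈ = trans (sym (lookup∘tabulate f x)) ([]=⇒lookup x∈)

∉⇒lookup≡false : ∀ {n} {x : Fin n} {p : Subset n} → x ∉ p → lookup p x ≡ false
∉⇒lookup≡false {x = x} {p} x∉p with lookup p x in p[x]
... | true  = contradiction (lookup⇒[]= x p p[x]) x∉p
... | false = refl

∩-distribʳ-∩ : ∀ {n} (r p q : Subset n) → (p ∩ q) ∩ r ≡ (p ∩ r) ∩ (q ∩ r)
∩-distribʳ-∩ r p q = ⊆-antisym lhs⊆rhs rhs⊆lhs
  where
  lhs⊆rhs : (p ∩ q) ∩ r ⊆ (p ∩ r) ∩ (q ∩ r)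
  lhs⊆rhs x∈ = let (x∈p∩q , x∈r) = x∈p∩q⁻ (p ∩ q) r x∈ ; (x∈p , x∈q) = x∈p∩q⁻ p q x∈p∩q
            in x∈p∩q⁺ (x∈p∩q⁺ (x∈p , x∈r) , x∈p∩q⁺ (x∈q , x∈r))
  rhs⊆lhs : (p ∩ r) ∩ (q ∩ r) ⊆ (p ∩ q) ∩ r
  rhs⊆lhs x∈ = let (x∈p∩r , x∈q∩r) = x∈p∩q⁻ (p ∩ r) (q ∩ r) x∈ ; (x∈p , x∈r) = x∈p∩q⁻ p r x∈p∩r
            in x∈p∩q⁺ (x∈p∩q⁺ (x∈p , proj₁ (x∈p∩q⁻ q r x∈q∩r)) , x∈r)

m∸o≡[m∸n]+[n∸o] : ∀ {m n o} → o ≤ n → n ≤ m → m ∸ o ≡ (m ∸ n) + (n ∸ o)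
m∸o≡[m∸n]+[n∸o] {m} {n} {o} o≤n n≤m = begin
  m ∸ o               ≡⟨ cong (_∸ o) (ℕₚ.m∸n+n≡m n≤m) ⟨
  (m ∸ n) + n ∸ o     ≡⟨ ℕₚ.+-∸-assoc (m ∸ n) o≤n ⟩
  (m ∸ n) + (n ∸ o)   ∎
  where open ≡-Reasoning

-- Matroids: spanning sets, flats and contraction

module Rank {n : ℕ} (M : Matroid n) where

  _spans_ : Subset n → Subset n → Set
  S spans E = S ⊆ E × rank M E ≤ rank M S

  _∈span_ : Fin n → Subset n → Set
  e ∈span T = rank M (T ∪ ⁅ e ⁆) ≤ rank M T

  Flat : Subset n → Set
  Flat F = ∀ e → e ∈span F → e ∈ F

  rank-Empty : ∀ {X} → Empty X → rank M X ≡ 0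
  rank-Empty {X} empty = ℕₚ.n≤0⇒n≡0
    (subst (λ X → rank M X ≤ 0) (sym (Empty-unique empty)) (subst (rank M ⊥ ≤_) (∣⊥∣≡0 n) (rank-bound M ⊥)))

  spans-∪ : ∀ {S X} → S spans X → ∀ Z → rank M (X ∪ Z) ≤ rank M (S ∪ Z)
  spans-∪ {S} {X} (S⊆X , rX≤rS) Z = ℕₚ.+-cancelʳ-≤ (rank M X) _ _ (begin
    rank M (X ∪ Z) + rank M X                   ≤⟨ ℕₚ.+-mono-≤ (rank-mono M (∪-monoʳ-⊆ X (q⊆p∪q S Z)))
                                                                (ℕₚ.≤-trans rX≤rS (rank-mono M S⊆X∩[S∪Z])) ⟩
    rank M (X ∪ (S ∪ Z)) + rank M (X ∩ (S ∪ Z)) ≤⟨ rank-submod M X (S ∪ Z) ⟩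
    rank M X + rank M (S ∪ Z)                   ≡⟨ ℕₚ.+-comm (rank M X) (rank M (S ∪ Z)) ⟩
    rank M (S ∪ Z) + rank M X                   ∎)
    where
    open ℕₚ.≤-Reasoning
    S⊆X∩[S∪Z] : S ⊆ X ∩ (S ∪ Z)
    S⊆X∩[S∪Z] x∈S = x∈p∩q⁺ (S⊆X x∈S , p⊆p∪q Z x∈S)

  spans⇒rank≡ : ∀ {S X} → S spans X → rank M X ≡ rank M S
  spans⇒rank≡ (S⊆X , rX≤rS) = ℕₚ.≤-antisym rX≤rS (rank-mono M S⊆X)

  spans⇒rank-∪≡ : ∀ {S X} → S spans X → ∀ Z → rank M (X ∪ Z) ≡ rank M (S ∪ Z)
  spans⇒rank-∪≡ S-spans Z = ℕₚ.≤-antisym (spans-∪ S-spans Z) (rank-mono M (∪-monoˡ-⊆ Z (proj₁ S-spans)))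

  private
    ∈ₗ⇒∈⋃ : ∀ {e : Fin n} {L} → e ∈ₗ L → e ∈ ⋃ (map ⁅_⁆ L)
    ∈ₗ⇒∈⋃ {L = e List.∷ L} (Any.here refl) = p⊆p∪q (⋃ (map ⁅_⁆ L)) (x∈⁅x⁆ e)
    ∈ₗ⇒∈⋃ {L = x List.∷ L} (Any.there e∈L) = q⊆p∪q ⁅ x ⁆ (⋃ (map ⁅_⁆ L)) (∈ₗ⇒∈⋃ e∈L)

    rank-∪-⋃≤ : ∀ T L → (∀ {e} → e ∈ₗ L → e ∈span T) → rank M (T ∪ ⋃ (map ⁅_⁆ L)) ≤ rank M T
    rank-∪-⋃≤ T List.[]      _      = ℕₚ.≤-reflexive (cong (rank M) (∪-identityʳ T))
    rank-∪-⋃≤ T (e List.∷ L) ⊆span = begin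
      rank M (T ∪ (⁅ e ⁆ ∪ U)) ≡⟨ cong (rank M) (∪-assoc T ⁅ e ⁆ U) ⟨
      rank M ((T ∪ ⁅ e ⁆) ∪ U) ≤⟨ spans-∪ (p⊆p∪q ⁅ e ⁆ , ⊆span (Any.here refl)) U ⟩
      rank M (T ∪ U)           ≤⟨ rank-∪-⋃≤ T L (⊆span ∘ Any.there) ⟩
      rank M T                 ∎
      where
      open ℕₚ.≤-Reasoning
      U = ⋃ (map ⁅_⁆ L)

  ⊆span⇒rank-∪≤ : ∀ {T Y} → (∀ {e} → e ∈ Y → e ∈span T) → rank M (T ∪ Y) ≤ rank M T
  ⊆span⇒rank-∪≤ {T} {Y} ⊆span = ℕₚ.≤-trans (rank-mono M (∪-monoʳ-⊆ T Y⊆⋃))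
    (rank-∪-⋃≤ T L (λ e∈L → ⊆span (proj₂ (∈-filter⁻ (_∈? Y) {xs = allFin n} e∈L))))
    where
    L = filter (_∈? Y) (allFin n)
    Y⊆⋃ : Y ⊆ ⋃ (map ⁅_⁆ L)
    Y⊆⋃ {e} e∈Y = ∈ₗ⇒∈⋃ (∈-filter⁺ (_∈? Y) (∈-allFin e) e∈Y)

  Flat-absorbs : ∀ {F X} → Flat F → rank M (F ∪ X) ≤ rank M F → X ⊆ F
  Flat-absorbs {F} flat r[F∪X]≤rF {e} e∈X =
    flat e (ℕₚ.≤-trans (rank-mono M (∪-monoʳ-⊆ F (x∈p⇒⁅x⁆⊆p e∈X))) r[F∪X]≤rF)

  ⊆-Flat : ∀ {S₁ E₁ S₂ E₂} → Flat E₂ → S₁ spans E₁ → S₂ spans E₂ →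
           rank M (S₁ ∪ S₂) ≤ rank M S₂ → E₁ ⊆ E₂
  ⊆-Flat {S₁} {E₁} {S₂} {E₂} flat S₁-spans S₂-spans r[S₁∪S₂]≤rS₂ = Flat-absorbs flat (begin
    rank M (E₂ ∪ E₁) ≡⟨ cong (rank M) (∪-comm E₂ E₁) ⟩
    rank M (E₁ ∪ E₂) ≤⟨ spans-∪ S₁-spans E₂ ⟩
    rank M (S₁ ∪ E₂) ≡⟨ cong (rank M) (∪-comm S₁ E₂) ⟩
    rank M (E₂ ∪ S₁) ≤⟨ spans-∪ S₂-spans S₁ ⟩
    rank M (S₂ ∪ S₁) ≡⟨ cong (rank M) (∪-comm S₂ S₁) ⟩
    rank M (S₁ ∪ S₂) ≤⟨ r[S₁∪S₂]≤rS₂ ⟩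
    rank M S₂        ≤⟨ rank-mono M (proj₁ S₂-spans) ⟩
    rank M E₂        ∎)
    where open ℕₚ.≤-Reasoning

module Contraction {n k : ℕ} (M : Matroid n) (owner : Fin n → Fin k) where
  open Market M owner using (rankC; SpanC)
  open Rank M

  private
    rank-∪-⁅⁆-swap : ∀ X F e → rank M ((X ∪ ⁅ e ⁆) ∪ F) ≡ rank M ((X ∪ F) ∪ ⁅ e ⁆)
    rank-∪-⁅⁆-swap X F e = cong (rank M) (begin
      (X ∪ ⁅ e ⁆) ∪ F ≡⟨ ∪-assoc X ⁅ e ⁆ F ⟩
      X ∪ (⁅ e ⁆ ∪ F) ≡⟨ cong (X ∪_) (∪-comm ⁅ e ⁆ F) ⟩
      X ∪ (F ∪ ⁅ e ⁆) ≡⟨ ∪-assoc X F ⁅ e ⁆ ⟨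
      (X ∪ F) ∪ ⁅ e ⁆ ∎)
      where open ≡-Reasoning

    not-∧-true : ∀ b {P : Set} (d : Dec P) → not b ∧ ⌊ d ⌋ ≡ true → b ≡ false × P
    not-∧-true false (yes p) _ = refl , p
    not-∧-true false (no _)  ()
    not-∧-true true  _       ()

  ∈-SpanC⁻ : ∀ {F X e} → e ∈ SpanC F X → e ∉ F × e ∈span (X ∪ F)
  ∈-SpanC⁻ {F} {X} {e} e∈S with not-∧-true (lookup F e) (rankC F (X ∪ ⁅ e ⁆) ≟ rankC F X) (∈-tabulate⁻ e∈S)
  ... | F[e]≡false , rankC≡ = e∉F , ℕₚ.≤-reflexive (trans (sym (rank-∪-⁅⁆-swap X F e)) rank≡)
    where
    e∉F : e ∉ F
    e∉F e∈F with () ← trans (sym ([]=⇒lookup e∈F)) F[e]≡false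
    rank≡ : rank M ((X ∪ ⁅ e ⁆) ∪ F) ≡ rank M (X ∪ F)
    rank≡ = ℕₚ.∸-cancelʳ-≡ (rank-mono M (q⊆p∪q _ F)) (rank-mono M (q⊆p∪q X F)) rankC≡

  ∈-SpanC⁺ : ∀ {F X e} → e ∉ F → e ∈span (X ∪ F) → e ∈ SpanC F X
  ∈-SpanC⁺ {F} {X} {e} e∉F e∈span = ∈-tabulate⁺ test
    where
    rankC≡ : rankC F (X ∪ ⁅ e ⁆) ≡ rankC F X
    rankC≡ = cong (_∸ rank M F)
      (trans (rank-∪-⁅⁆-swap X F e) (ℕₚ.≤-antisym e∈span (rank-mono M (p⊆p∪q ⁅ e ⁆))))
    test : not (lookup F e) ∧ ⌊ rankC F (X ∪ ⁅ e ⁆) ≟ rankC F X ⌋ ≡ true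
    test rewrite ∉⇒lookup≡false e∉F with rankC F (X ∪ ⁅ e ⁆) ≟ rankC F X
    ... | yes _ = refl
    ... | no  ≢ = contradiction rankC≡ ≢

  ⊆-SpanC : ∀ {F X} → (∀ {e} → e ∈ X → e ∉ F) → X ⊆ SpanC F X
  ⊆-SpanC {F} {X} X∩F≡∅ e∈X =
    ∈-SpanC⁺ (X∩F≡∅ e∈X) (rank-mono M (∪-⊆ ⊆-refl (x∈p⇒⁅x⁆⊆p (p⊆p∪q F e∈X))))

  rank-∪-SpanC : ∀ F X → rank M (F ∪ SpanC F X) ≤ rank M (X ∪ F)
  rank-∪-SpanC F X = ℕₚ.≤-trans (rank-mono M (∪-monoˡ-⊆ (SpanC F X) (q⊆p∪q X F)))
                                (⊆span⇒rank-∪≤ (proj₂ ∘ ∈-SpanC⁻))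

  Flat-∪-SpanC : ∀ {F X} → (∀ {e} → e ∈ X → e ∉ F) → Flat (F ∪ SpanC F X)
  Flat-∪-SpanC {F} {X} X∩F≡∅ e e∈span with e ∈? F
  ... | yes e∈F = p⊆p∪q (SpanC F X) e∈F
  ... | no  e∉F = q⊆p∪q F (SpanC F X) (∈-SpanC⁺ e∉F (begin
    rank M ((X ∪ F) ∪ ⁅ e ⁆)           ≤⟨ rank-mono M (∪-monoˡ-⊆ ⁅ e ⁆ X∪F⊆F∪S) ⟩
    rank M ((F ∪ SpanC F X) ∪ ⁅ e ⁆)   ≤⟨ e∈span ⟩
    rank M (F ∪ SpanC F X)             ≤⟨ rank-∪-SpanC F X ⟩
    rank M (X ∪ F)                     ∎))
    where
    open ℕₚ.≤-Reasoning
    X∪F⊆F∪S : X ∪ F ⊆ F ∪ SpanC F X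
    X∪F⊆F∪S = ∪-⊆ (⊆-trans (⊆-SpanC X∩F≡∅) (q⊆p∪q F _)) (p⊆p∪q _)

module Buyers {n k : ℕ} (M : Matroid n) (owner : Fin n → Fin k) where
  open Market M owner using (N)

  ∈N⁺ : ∀ {B e} → owner e ∈ B → e ∈ N B
  ∈N⁺ owner[e]∈B = ∈-tabulate⁺ ([]=⇒lookup owner[e]∈B)

  ∈N⁻ : ∀ {B e} → e ∈ N B → owner e ∈ B
  ∈N⁻ {B} {e} e∈NB = lookup⇒[]= (owner e) B (∈-tabulate⁻ e∈NB)

  N-mono : ∀ {B B′} → B ⊆ B′ → N B ⊆ N B′
  N-mono B⊆B′ = ∈N⁺ ∘ B⊆B′ ∘ ∈N⁻

  N-∪ : ∀ X Y → N (X ∪ Y) ≡ N X ∪ N Y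
  N-∪ X Y = ⊆-antisym
    (λ e∈ → [ p⊆p∪q (N Y) ∘ ∈N⁺ , q⊆p∪q (N X) (N Y) ∘ ∈N⁺ ]′ (x∈p∪q⁻ X Y (∈N⁻ {X ∪ Y} e∈)))
    (∪-⊆ (N-mono (p⊆p∪q {p = X} Y)) (N-mono (q⊆p∪q X Y)))

  N-∩ : ∀ X Y → N (X ∩ Y) ⊆ N X ∩ N Y
  N-∩ X Y e∈ = let (x , y) = x∈p∩q⁻ X Y (∈N⁻ e∈) in x∈p∩q⁺ (∈N⁺ x , ∈N⁺ y)

  rankN : Subset k → ℕ
  rankN X = rank M (N X)

  rankN-mono : ∀ {X Y} → X ⊆ Y → rankN X ≤ rankN Y
  rankN-mono = rank-mono M ∘ N-mono

  rankN-submodular : ∀ X Y → rankN (X ∪ Y) + rankN (X ∩ Y) ≤ rankN X + rankN Y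
  rankN-submodular X Y = begin
    rankN (X ∪ Y) + rankN (X ∩ Y)            ≤⟨ ℕₚ.+-monoʳ-≤ (rankN (X ∪ Y)) (rank-mono M (N-∩ X Y)) ⟩
    rank M (N (X ∪ Y)) + rank M (N X ∩ N Y)  ≡⟨ cong (λ Z → rank M Z + rank M (N X ∩ N Y)) (N-∪ X Y) ⟩
    rank M (N X ∪ N Y) + rank M (N X ∩ N Y)  ≤⟨ rank-submod M (N X) (N Y) ⟩
    rankN X + rankN Y                        ∎
    where open ℕₚ.≤-Reasoning

  rankN-Empty : ∀ {X} → Empty X → rankN X ≡ 0
  rankN-Empty empty = Rank.rank-Empty M (λ (e , e∈NX) → empty (owner e , ∈N⁻ e∈NX))

-- The MI skeleton algorithm and its level sets

module Skeleton {n k : ℕ} (M : Matroid n) (owner : Fin n → Fin k) (A : Subset k) (p : Fin n → ℚ) where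
  open Market M owner
  open Rank M
  open Contraction M owner
  open Buyers M owner

  budget : Subset k → ℕ
  budget X = ∣ X ∩ A ∣

  marginal : Subset k → Subset k → ℕ
  marginal C Z = rankN (C ∪ Z) ∸ rankN C

  surplus : ℚ → Subset k → ℚ
  surplus l X = excess l (budget X) (rankN X)

  budget-∪ : ∀ X Y → Empty (X ∩ Y) → budget (X ∪ Y) ≡ budget X + budget Y
  budget-∪ X Y X∩Y≡∅ = trans (cong ∣_∣ (∩-distribʳ-∪ A X Y)) (∣p∪q∣≡∣p∣+∣q∣ (X ∩ A) (Y ∩ A) disjoint)
    where
    disjoint : Empty ((X ∩ A) ∩ (Y ∩ A))
    disjoint (i , i∈) = X∩Y≡∅ (i , proj₁ (x∈p∩q⁻ (X ∩ Y) A (subst (i ∈_) (sym (∩-distribʳ-∩ A X Y)) i∈)))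

  budget-modular : ∀ X Y → budget (X ∪ Y) + budget (X ∩ Y) ≡ budget X + budget Y
  budget-modular X Y rewrite ∩-distribʳ-∪ A X Y | ∩-distribʳ-∩ A X Y = ∣p∪q∣+∣p∩q∣≡∣p∣+∣q∣ (X ∩ A) (Y ∩ A)

  surplus-supermodular : ∀ {l} → 0ℚ ≤ℚ l → ∀ X Y →
                         surplus l X ℚ.+ surplus l Y ≤ℚ surplus l (X ∪ Y) ℚ.+ surplus l (X ∩ Y)
  surplus-supermodular {l} 0≤l X Y = begin
    surplus l X ℚ.+ surplus l Y                   ≡⟨ excess-+ l _ _ _ _ ⟨
    excess l (budget X + budget Y) (rankN X + rankN Y)
                                                  ≡⟨ cong (λ a → excess l a (rankN X + rankN Y)) (budget-modular X Y) ⟨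
    excess l a⋃⋂ (rankN X + rankN Y)              ≤⟨ excess-antitone a⋃⋂ 0≤l (rankN-submodular X Y) ⟩
    excess l a⋃⋂ (rankN (X ∪ Y) + rankN (X ∩ Y))  ≡⟨ excess-+ l _ _ _ _ ⟩
    surplus l (X ∪ Y) ℚ.+ surplus l (X ∩ Y)       ∎
    where
    open ℚₚ.≤-Reasoning
    a⋃⋂ = budget (X ∪ Y) + budget (X ∩ Y)

  surplus-∪ : ∀ l C Z → Empty (C ∩ Z) →
              surplus l (C ∪ Z) ≡ surplus l C ℚ.+ excess l (budget Z) (marginal C Z)
  surplus-∪ l C Z C∩Z≡∅ = begin
    excess l (budget (C ∪ Z)) (rankN (C ∪ Z))                ≡⟨ cong₂ (excess l) (budget-∪ C Z C∩Z≡∅) rankN≡ ⟩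
    excess l (budget C + budget Z) (rankN C + marginal C Z)  ≡⟨ excess-+ l _ _ _ _ ⟩
    surplus l C ℚ.+ excess l (budget Z) (marginal C Z)       ∎
    where
    open ≡-Reasoning
    rankN≡ : rankN (C ∪ Z) ≡ rankN C + marginal C Z
    rankN≡ = trans (sym (ℕₚ.m∸n+n≡m (rankN-mono (p⊆p∪q {p = C} Z)))) (ℕₚ.+-comm _ (rankN C))

  marginal-∪ : ∀ C B Z → marginal C (Z ∪ B) ≡ marginal (C ∪ B) Z + marginal C B
  marginal-∪ C B Z = begin
    rankN (C ∪ (Z ∪ B)) ∸ rankN C      ≡⟨ cong (λ X → rankN X ∸ rankN C) C∪[Z∪B]≡[C∪B]∪Z ⟩
    rankN ((C ∪ B) ∪ Z) ∸ rankN C      ≡⟨ m∸o≡[m∸n]+[n∸o] (rankN-mono (p⊆p∪q {p = C} B))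
                                                          (rankN-mono (p⊆p∪q {p = C ∪ B} Z)) ⟩
    marginal (C ∪ B) Z + marginal C B  ∎
    where
    open ≡-Reasoning
    C∪[Z∪B]≡[C∪B]∪Z : C ∪ (Z ∪ B) ≡ (C ∪ B) ∪ Z
    C∪[Z∪B]≡[C∪B]∪Z = trans (cong (C ∪_) (∪-comm Z B)) (sym (∪-assoc C B Z))

  ratio-0 : ∀ d → ratio 0 d ≡ 0ℚ
  ratio-0 zero    = refl
  ratio-0 (suc d) = ℚₚ.0/n≡0 (suc d)

  ratio≤⇒≤* : ∀ {ρ} a d → (d ≡ 0 → a ≡ 0) → ratio a d ≤ℚ ρ → fromℕ a ≤ℚ ρ ℚ.* fromℕ d
  ratio≤⇒≤* {ρ} a zero    d≡0⇒a≡0 _ rewrite d≡0⇒a≡0 refl = ℚₚ.≤-reflexive (sym (ℚₚ.*-zeroʳ ρ))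
  ratio≤⇒≤* {ρ} a (suc d) _ a/d≤ρ =
    subst (_≤ℚ ρ ℚ.* fromℕ (suc d)) (/-*-denominator a d) (*-monoʳ-≤-fromℕ (suc d) a/d≤ρ)

  ratio≡⇒≡* : ∀ {ρ} a d → (d ≡ 0 → a ≡ 0) → ratio a d ≡ ρ → fromℕ a ≡ ρ ℚ.* fromℕ d
  ratio≡⇒≡* {ρ} a zero    d≡0⇒a≡0 _ rewrite d≡0⇒a≡0 refl = sym (ℚₚ.*-zeroʳ ρ)
  ratio≡⇒≡*     a (suc d) _       refl = sym (/-*-denominator a d)

  RatiosAtMost : ℚ → Subset k → Subset k → Set
  RatiosAtMost t C Brem = ∀ Z → Z ⊆ Brem → fromℕ (budget Z) ≤ℚ t ℚ.* fromℕ (marginal C Z)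

  RatiosAtMost-mono : ∀ {s t C Brem} → s ≤ℚ t → RatiosAtMost s C Brem → RatiosAtMost t C Brem
  RatiosAtMost-mono {C = C} s≤t ratios≤s Z Z⊆Brem =
    ℚₚ.≤-trans (ratios≤s Z Z⊆Brem) (*-monoʳ-≤-fromℕ (marginal C Z) s≤t)

  -- The state (E_ℓ, B^rem_ℓ) of a run, with C = B_1 ∪ ⋯ ∪ B_ℓ.  The last field excludes the
  -- junk value ratio a 0 = 0 for a > 0.
  record Invariant (E : Subset n) (Brem C : Subset k) : Set where
    field
      processed∉remaining    : ∀ {i} → i ∈ C → i ∉ Brem
      processed-or-remaining : ∀ i → i ∈ C ⊎ i ∈ Brem
      N-spans                : N C spans E
      budget-needs-rank      : ∀ Z → Z ⊆ Brem → marginal C Z ≡ 0 → budget Z ≡ 0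

  module InvariantProperties {E Brem C} (inv : Invariant E Brem C) where
    open Invariant inv

    InvExp≡ratio : ∀ Z → InvExp A E Z ≡ ratio (budget Z) (marginal C Z)
    InvExp≡ratio Z = cong (ratio (budget Z)) (cong₂ _∸_ rank≡ (spans⇒rank≡ N-spans))
      where
      open ≡-Reasoning
      rank≡ : rank M ((N Z ─ E) ∪ E) ≡ rankN (C ∪ Z)
      rank≡ = begin
        rank M ((N Z ─ E) ∪ E) ≡⟨ cong (rank M) (trans (∪-comm (N Z ─ E) E) (p∪[q─p]≡p∪q E (N Z))) ⟩
        rank M (E ∪ N Z)       ≡⟨ spans⇒rank-∪≡ N-spans (N Z) ⟩
        rank M (N C ∪ N Z)     ≡⟨ cong (rank M) (N-∪ C Z) ⟨
        rankN (C ∪ Z)          ∎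

    surplus-split : ∀ l W → C ⊆ W →
                    surplus l W ≡ surplus l C ℚ.+ excess l (budget (W ─ C)) (marginal C (W ─ C))
    surplus-split l W C⊆W = trans (cong (surplus l) (sym C∪[W─C]≡W)) (surplus-∪ l C (W ─ C) C∩[W─C]≡∅)
      where
      C∪[W─C]≡W : C ∪ (W ─ C) ≡ W
      C∪[W─C]≡W = trans (p∪[q─p]≡p∪q C W) (p⊆q⇒p∪q≡q C⊆W)
      C∩[W─C]≡∅ : Empty (C ∩ (W ─ C))
      C∩[W─C]≡∅ (i , i∈) = let (i∈C , i∈W─C) = x∈p∩q⁻ C (W ─ C) i∈ in x∈p─q⇒x∉q W C i∈W─C i∈C

    ─processed⊆remaining : ∀ W → W ─ C ⊆ Brem
    ─processed⊆remaining W {i} i∈W─C =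
      [ (λ i∈C → contradiction i∈C (x∈p─q⇒x∉q W C i∈W─C)) , (λ i∈Brem → i∈Brem) ]′ (processed-or-remaining i)

    finished⇒all-in-E : Brem ≡ ⊥ → ∀ e → e ∈ E
    finished⇒all-in-E refl e =
      [ (λ i∈C → proj₁ N-spans (∈N⁺ i∈C)) , (λ i∈⊥ → contradiction i∈⊥ ∉⊥) ]′ (processed-or-remaining (owner e))

  -- The empty alternative is needed because ∅ is not a flat when M has loops.
  FlatOrEmpty : Subset n → Subset k → Set
  FlatOrEmpty E C = (Flat E × 1 ≤ rankN C) ⊎ (Empty C × Empty E)

  record LevelSet (l : ℚ) (C : Subset k) : Set where
    field
      buyers          : Subset k
      elements        : Subset n
      surplus-maximal : ∀ W → C ⊆ W → surplus l W ≤ℚ surplus l buyers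
      rank-maximal    : ∀ W → C ⊆ W → surplus l W ≡ surplus l buyers → rankN (W ∪ buyers) ≤ rankN buyers
      ≥l⇒∈            : ∀ e → l ≤ℚ p e → e ∈ elements
      ∈⇒≥l            : ∀ e → e ∈ elements → l ≤ℚ p e
      N-spans         : N buyers spans elements
      flat-or-empty   : FlatOrEmpty elements buyers

  module Step {E Brem C} (inv : Invariant E Brem C) (ρ : ℚ) (B : Subset k)
    (ρ-max : ∀ B′ → B′ ⊆ Brem → InvExp A E B′ ≤ℚ ρ) (B⊆Brem : B ⊆ Brem) (ρ-attained : InvExp A E B ≡ ρ) where
    open Invariant inv
    open InvariantProperties inv

    ρ-nonNeg : 0ℚ ≤ℚ ρ
    ρ-nonNeg = subst (_≤ℚ ρ) InvExp⊥≡0 (ρ-max ⊥ ⊥⊆)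
      where
      InvExp⊥≡0 : InvExp A E ⊥ ≡ 0ℚ
      InvExp⊥≡0 = trans (cong (λ a → ratio a (rankC E (N ⊥ ─ E))) (trans (cong ∣_∣ (∩-zeroˡ A)) (∣⊥∣≡0 k)))
                        (ratio-0 (rankC E (N ⊥ ─ E)))

    ratios≤ρ : RatiosAtMost ρ C Brem
    ratios≤ρ Z Z⊆Brem = ratio≤⇒≤* (budget Z) (marginal C Z) (budget-needs-rank Z Z⊆Brem)
      (subst (_≤ℚ ρ) (InvExp≡ratio Z) (ρ-max Z Z⊆Brem))

    budget≡ρ*marginal : fromℕ (budget B) ≡ ρ ℚ.* fromℕ (marginal C B)
    budget≡ρ*marginal = ratio≡⇒≡* (budget B) (marginal C B) (budget-needs-rank B B⊆Brem)
      (trans (sym (InvExp≡ratio B)) ρ-attained)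

    marginal≡0⇒ρ≡0 : marginal C B ≡ 0 → ρ ≡ 0ℚ
    marginal≡0⇒ρ≡0 marginal≡0 = trans (sym ρ-attained) (trans (InvExp≡ratio B) (cong (ratio (budget B)) marginal≡0))

    ρ-least : ∀ {t} → 0ℚ ≤ℚ t → RatiosAtMost t C Brem → ρ ≤ℚ t
    ρ-least {t} 0≤t ratios≤t with marginal C B in marginal≡ | ratios≤t B B⊆Brem
    ... | zero  | _         = subst (_≤ℚ t) (sym (marginal≡0⇒ρ≡0 marginal≡)) 0≤t
    ... | suc d | budget≤td = *-cancelʳ-≤-fromℕ-suc d
      (subst (_≤ℚ t ℚ.* fromℕ (suc d)) (trans budget≡ρ*marginal (cong (λ u → ρ ℚ.* fromℕ u) marginal≡)) budget≤td)

    0<ρ⇒1≤rankN : 0ℚ < ρ → 1 ≤ rankN (C ∪ B)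
    0<ρ⇒1≤rankN 0<ρ with marginal C B in marginal≡
    ... | zero  = contradiction (sym (marginal≡0⇒ρ≡0 marginal≡)) (ℚₚ.<⇒≢ 0<ρ)
    ... | suc d = ℕₚ.≤-trans (s≤s z≤n) (subst (_≤ rankN (C ∪ B)) marginal≡ (ℕₚ.m∸n≤m _ (rankN C)))

    X : Subset n
    X = N B ─ E

    S : Subset n
    S = SpanC E X

    E′ : Subset n
    E′ = E ∪ S

    C′ : Subset k
    C′ = C ∪ B

    Brem′ : Subset k
    Brem′ = Brem ─ B

    X∩E≡∅ : ∀ {e} → e ∈ X → e ∉ E
    X∩E≡∅ = x∈p─q⇒x∉q (N B) E

    N-spans′ : N C′ spans E′
    N-spans′ = subst (_⊆ E′) (sym (N-∪ C B)) NC∪NB⊆E′ , (begin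
      rank M E′           ≤⟨ rank-∪-SpanC E X ⟩
      rank M (X ∪ E)      ≤⟨ rank-mono M (∪-monoˡ-⊆ E (p─q⊆p (N B) E)) ⟩
      rank M (N B ∪ E)    ≡⟨ cong (rank M) (∪-comm (N B) E) ⟩
      rank M (E ∪ N B)    ≡⟨ spans⇒rank-∪≡ N-spans (N B) ⟩
      rank M (N C ∪ N B)  ≡⟨ cong (rank M) (N-∪ C B) ⟨
      rankN C′            ∎)
      where
      open ℕₚ.≤-Reasoning
      NC∪NB⊆E′ : N C ∪ N B ⊆ E′
      NC∪NB⊆E′ = ∪-⊆ (⊆-trans (proj₁ N-spans) (p⊆p∪q S))
                     (⊆-trans (p⊆q∪[p─q] (N B) E) (∪-monoʳ-⊆ E (⊆-SpanC X∩E≡∅)))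

    ratios′≤ρ : RatiosAtMost ρ C′ Brem′
    ratios′≤ρ Z Z⊆Brem′ = a+b≤ρ[u+v]∧b≡ρv⇒a≤ρu {ρ}
      (subst₂ (λ a u → fromℕ a ≤ℚ ρ ℚ.* fromℕ u) (budget-∪ Z B Z∩B≡∅) (marginal-∪ C B Z)
              (ratios≤ρ (Z ∪ B) (∪-⊆ (⊆-trans Z⊆Brem′ (p─q⊆p Brem B)) B⊆Brem)))
      budget≡ρ*marginal
      where
      Z∩B≡∅ : Empty (Z ∩ B)
      Z∩B≡∅ (i , i∈) = let (i∈Z , i∈B) = x∈p∩q⁻ Z B i∈ in x∈p─q⇒x∉q Brem B (Z⊆Brem′ i∈Z) i∈B

    invariant′ : Invariant E′ Brem′ C′
    invariant′ = record
      { processed∉remaining    = processed∉remaining′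
      ; processed-or-remaining = processed-or-remaining′
      ; N-spans                = N-spans′
      ; budget-needs-rank      = budget-needs-rank′
      }
      where
      processed∉remaining′ : ∀ {i} → i ∈ C′ → i ∉ Brem′
      processed∉remaining′ {i} i∈C′ i∈Brem′ with x∈p∪q⁻ C B i∈C′
      ... | inj₁ i∈C = processed∉remaining i∈C (p─q⊆p Brem B i∈Brem′)
      ... | inj₂ i∈B = x∈p─q⇒x∉q Brem B i∈Brem′ i∈B
      processed-or-remaining′ : ∀ i → i ∈ C′ ⊎ i ∈ Brem′
      processed-or-remaining′ i with processed-or-remaining i | i ∈? B
      ... | inj₁ i∈C    | _       = inj₁ (p⊆p∪q B i∈C)
      ... | inj₂ _      | yes i∈B = inj₁ (q⊆p∪q C B i∈B)
      ... | inj₂ i∈Brem | no  i∉B = inj₂ (x∈p∧x∉q⇒x∈p─q i∈Brem i∉B)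
      budget-needs-rank′ : ∀ Z → Z ⊆ Brem′ → marginal C′ Z ≡ 0 → budget Z ≡ 0
      budget-needs-rank′ Z Z⊆Brem′ marginal≡0 = ℕₚ.n≤0⇒n≡0 (fromℕ-cancel-≤ (ℚₚ.≤-trans
        (ratios′≤ρ Z Z⊆Brem′)
        (ℚₚ.≤-reflexive (trans (cong (λ u → ρ ℚ.* fromℕ u) marginal≡0) (ℚₚ.*-zeroʳ ρ)))))

    Flat-E′ : Flat E′
    Flat-E′ = Flat-∪-SpanC X∩E≡∅

    surplus-C′ : ∀ l → surplus l C′ ≡ surplus l C ℚ.+ excess l (budget B) (marginal C B)
    surplus-C′ l = surplus-∪ l C B C∩B≡∅
      where
      C∩B≡∅ : Empty (C ∩ B)
      C∩B≡∅ (i , i∈) = let (i∈C , i∈B) = x∈p∩q⁻ C B i∈ in processed∉remaining i∈C (B⊆Brem i∈B)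

    -- By supermodularity it suffices that W ∩ C′ is no better than C′, as ρ is the largest ratio.
    surplus-≤-∪C′ : ∀ {l} → 0ℚ ≤ℚ l → l ≤ℚ ρ → ∀ W → C ⊆ W → surplus l W ≤ℚ surplus l (W ∪ C′)
    surplus-≤-∪C′ {l} 0≤l l≤ρ W C⊆W = p+q≤r+s∧s≤q⇒p≤r (surplus-supermodular 0≤l W C′) (begin
      surplus l (W ∩ C′)                                      ≡⟨ surplus-split l (W ∩ C′) C⊆W∩C′ ⟩
      surplus l C ℚ.+ excess l (budget Z) (marginal C Z)      ≤⟨ ℚₚ.+-monoʳ-≤ (surplus l C) (excess-mono
                                                                   (ratios≤ρ Z (─processed⊆remaining (W ∩ C′)))
                                                                   budget≡ρ*marginal marginal≤ l≤ρ) ⟩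
      surplus l C ℚ.+ excess l (budget B) (marginal C B)      ≡⟨ surplus-C′ l ⟨
      surplus l C′                                            ∎)
      where
      open ℚₚ.≤-Reasoning
      Z = (W ∩ C′) ─ C
      C⊆W∩C′ : C ⊆ W ∩ C′
      C⊆W∩C′ i∈C = x∈p∩q⁺ (C⊆W i∈C , p⊆p∪q B i∈C)
      Z⊆B : Z ⊆ B
      Z⊆B i∈Z = x∈p∪q∧x∉p⇒x∈q (proj₂ (x∈p∩q⁻ W C′ (p─q⊆p (W ∩ C′) C i∈Z))) (x∈p─q⇒x∉q (W ∩ C′) C i∈Z)
      marginal≤ : marginal C Z ≤ marginal C B
      marginal≤ = ℕₚ.∸-monoˡ-≤ (rankN C) (rankN-mono (∪-monoʳ-⊆ C Z⊆B))

    prices-≤-step : ∀ {t} → 0ℚ ≤ℚ t → RatiosAtMost t C Brem → (∀ e → e ∈ S → p e ≡ ρ) →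
                    (RatiosAtMost t C′ Brem′ → ∀ e → e ∉ E′ → p e ≤ℚ t) → ∀ e → e ∉ E → p e ≤ℚ t
    prices-≤-step 0≤t ratios≤t priced later e e∉E with e ∈? S
    ... | yes e∈S = ℚₚ.≤-trans (ℚₚ.≤-reflexive (priced e e∈S)) (ρ-least 0≤t ratios≤t)
    ... | no  e∉S = later (RatiosAtMost-mono {C = C′} (ρ-least 0≤t ratios≤t) ratios′≤ρ) e (x∉p∧x∉q⇒x∉p∪q e∉E e∉S)

    prices-nonNeg-step : (∀ e → e ∈ S → p e ≡ ρ) → (∀ e → e ∉ E′ → 0ℚ ≤ℚ p e) → ∀ e → e ∉ E → 0ℚ ≤ℚ p e
    prices-nonNeg-step priced later e e∉E with e ∈? S
    ... | yes e∈S = subst (0ℚ ≤ℚ_) (sym (priced e e∈S)) ρ-nonNeg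
    ... | no  e∉S = later e (x∉p∧x∉q⇒x∉p∪q e∉E e∉S)

    E′-≥ : ∀ {l} → l ≤ℚ ρ → (∀ e → e ∈ S → p e ≡ ρ) → (∀ e → e ∈ E → l ≤ℚ p e) → ∀ e → e ∈ E′ → l ≤ℚ p e
    E′-≥ l≤ρ priced E-≥ e e∈E′ with x∈p∪q⁻ E S e∈E′
    ... | inj₁ e∈E = E-≥ e e∈E
    ... | inj₂ e∈S = ℚₚ.≤-trans l≤ρ (ℚₚ.≤-reflexive (sym (priced e e∈S)))

    levelSet-stop : ∀ {l} → ρ < l → FlatOrEmpty E C → (∀ e → e ∈ E → l ≤ℚ p e) →
                    (∀ e → e ∉ E → p e ≤ℚ ρ) → LevelSet l C
    levelSet-stop {l} ρ<l flat-or-empty E-≥ unpriced-≤ρ = record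
      { buyers          = C
      ; elements        = E
      ; surplus-maximal = surplus-maximal
      ; rank-maximal    = rank-maximal
      ; ≥l⇒∈            = ≥l⇒∈
      ; ∈⇒≥l            = E-≥
      ; N-spans         = N-spans
      ; flat-or-empty   = flat-or-empty
      }
      where
      bound : ∀ W → fromℕ (budget (W ─ C)) ≤ℚ ρ ℚ.* fromℕ (marginal C (W ─ C))
      bound W = ratios≤ρ (W ─ C) (─processed⊆remaining W)

      surplus-maximal : ∀ W → C ⊆ W → surplus l W ≤ℚ surplus l C
      surplus-maximal W C⊆W = begin
        surplus l W                                                     ≡⟨ surplus-split l W C⊆W ⟩
        surplus l C ℚ.+ excess l (budget (W ─ C)) (marginal C (W ─ C)) ≤⟨ ℚₚ.+-monoʳ-≤ (surplus l C)
                                                                             (excess-nonPos (bound W) (ℚₚ.<⇒≤ ρ<l)) ⟩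
        surplus l C ℚ.+ 0ℚ                                              ≡⟨ ℚₚ.+-identityʳ (surplus l C) ⟩
        surplus l C                                                     ∎
        where open ℚₚ.≤-Reasoning

      rank-maximal : ∀ W → C ⊆ W → surplus l W ≡ surplus l C → rankN (W ∪ C) ≤ rankN C
      rank-maximal W C⊆W surplus≡ = ℕₚ.m∸n≡0⇒m≤n (begin
        rankN (W ∪ C) ∸ rankN C       ≡⟨ cong (λ Y → rankN Y ∸ rankN C) (trans (∪-comm W C) (sym (p∪[q─p]≡p∪q C W))) ⟩
        marginal C (W ─ C)            ≡⟨ excess≡0⇒≡0 (marginal C (W ─ C)) excess≡0 (bound W) ρ<l ⟩
        0                             ∎)
        where
        open ≡-Reasoning
        excess≡0 : excess l (budget (W ─ C)) (marginal C (W ─ C)) ≡ 0ℚ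
        excess≡0 = identityʳ-unique (surplus l C) _ (trans (sym (surplus-split l W C⊆W)) surplus≡)

      ≥l⇒∈ : ∀ e → l ≤ℚ p e → e ∈ E
      ≥l⇒∈ e l≤pe with e ∈? E
      ... | yes e∈E = e∈E
      ... | no  e∉E = contradiction (ℚₚ.≤-trans l≤pe (unpriced-≤ρ e e∉E)) (<⇒≱ ρ<l)

    levelSet-extend : ∀ {l} → 0ℚ < l → l ≤ℚ ρ → LevelSet l C′ → LevelSet l C
    levelSet-extend {l} 0<l l≤ρ later = record
      { buyers          = buyers
      ; elements        = elements
      ; surplus-maximal = surplus-maximal′
      ; rank-maximal    = rank-maximal′
      ; ≥l⇒∈            = ≥l⇒∈
      ; ∈⇒≥l            = ∈⇒≥l
      ; N-spans         = LevelSet.N-spans later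
      ; flat-or-empty   = flat-or-empty
      }
      where
      open LevelSet later hiding (N-spans)
      ≤-with-C′ : ∀ W → C ⊆ W → surplus l W ≤ℚ surplus l (W ∪ C′)
      ≤-with-C′ = surplus-≤-∪C′ (ℚₚ.<⇒≤ 0<l) l≤ρ

      surplus-maximal′ : ∀ W → C ⊆ W → surplus l W ≤ℚ surplus l buyers
      surplus-maximal′ W C⊆W = ℚₚ.≤-trans (≤-with-C′ W C⊆W) (surplus-maximal (W ∪ C′) (q⊆p∪q W C′))

      rank-maximal′ : ∀ W → C ⊆ W → surplus l W ≡ surplus l buyers → rankN (W ∪ buyers) ≤ rankN buyers
      rank-maximal′ W C⊆W surplus≡ = ℕₚ.≤-trans (rankN-mono (∪-monoˡ-⊆ buyers (p⊆p∪q {p = W} C′)))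
        (rank-maximal (W ∪ C′) (q⊆p∪q W C′) (ℚₚ.≤-antisym (surplus-maximal (W ∪ C′) (q⊆p∪q W C′))
          (subst (_≤ℚ surplus l (W ∪ C′)) surplus≡ (≤-with-C′ W C⊆W))))

  levelSet-finished : ∀ {l E C} → Invariant E ⊥ C → FlatOrEmpty E C → (∀ e → e ∈ E → l ≤ℚ p e) → LevelSet l C
  levelSet-finished {l} {E} {C} inv flat-or-empty E-≥ = record
    { buyers          = C
    ; elements        = E
    ; surplus-maximal = λ W C⊆W → ℚₚ.≤-reflexive (cong (surplus l) (⊆-antisym (λ _ → all-in-C) C⊆W))
    ; rank-maximal    = λ W _ _ → rankN-mono (∪-⊆ {p = W} (λ _ → all-in-C) ⊆-refl)
    ; ≥l⇒∈            = λ e _ → finished⇒all-in-E refl e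
    ; ∈⇒≥l            = E-≥
    ; N-spans         = N-spans
    ; flat-or-empty   = flat-or-empty
    }
    where
    open Invariant inv
    open InvariantProperties inv
    all-in-C : ∀ {i} → i ∈ C
    all-in-C {i} = [ (λ i∈C → i∈C) , (λ i∈⊥ → contradiction i∈⊥ ∉⊥) ]′ (processed-or-remaining i)

  prices-≤ : ∀ {E Brem C t} → Invariant E Brem C → 0ℚ ≤ℚ t → RatiosAtMost t C Brem →
             Run A p E Brem → ∀ e → e ∉ E → p e ≤ℚ t
  prices-≤ inv _ _ done e e∉E = contradiction (InvariantProperties.finished⇒all-in-E inv refl e) e∉E
  prices-≤ inv 0≤t ratios≤t (step ρ B ρ-max B⊆Brem ρ-attained _ priced run) =
    prices-≤-step 0≤t ratios≤t priced (λ ratios′≤t → prices-≤ invariant′ 0≤t ratios′≤t run)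
    where open Step inv ρ B ρ-max B⊆Brem ρ-attained

  prices-nonNeg : ∀ {E Brem C} → Invariant E Brem C → Run A p E Brem → ∀ e → e ∉ E → 0ℚ ≤ℚ p e
  prices-nonNeg inv done e e∉E = contradiction (InvariantProperties.finished⇒all-in-E inv refl e) e∉E
  prices-nonNeg inv (step ρ B ρ-max B⊆Brem ρ-attained _ priced run) =
    prices-nonNeg-step priced (prices-nonNeg invariant′ run)
    where open Step inv ρ B ρ-max B⊆Brem ρ-attained

  levelSet : ∀ {l} → 0ℚ < l → ∀ {E Brem C} → Invariant E Brem C → FlatOrEmpty E C →
             (∀ e → e ∈ E → l ≤ℚ p e) → Run A p E Brem → LevelSet l C
  levelSet 0<l inv flat-or-empty E-≥ done = levelSet-finished inv flat-or-empty E-≥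
  levelSet {l} 0<l inv flat-or-empty E-≥ run@(step ρ B ρ-max B⊆Brem ρ-attained _ priced run′) with ρ ℚₚ.<? l
  ... | yes ρ<l = levelSet-stop ρ<l flat-or-empty E-≥ (prices-≤ inv ρ-nonNeg ratios≤ρ run)
    where open Step inv ρ B ρ-max B⊆Brem ρ-attained
  ... | no  ρ≮l = levelSet-extend 0<l l≤ρ
    (levelSet 0<l invariant′ (inj₁ (Flat-E′ , 0<ρ⇒1≤rankN (ℚₚ.<-≤-trans 0<l l≤ρ))) (E′-≥ l≤ρ priced E-≥) run′)
    where
    open Step inv ρ B ρ-max B⊆Brem ρ-attained
    l≤ρ : l ≤ℚ ρ
    l≤ρ = ℚₚ.≮⇒≥ ρ≮l

  initial-invariant : (∀ i → i ∈ A → 1 ≤ rank M (P i)) → Invariant ⊥ ⊤ ⊥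
  initial-invariant nondegenerate = record
    { processed∉remaining    = λ i∈⊥ _ → ∉⊥ i∈⊥
    ; processed-or-remaining = λ _ → inj₂ ∈⊤
    ; N-spans                = (λ e∈N⊥ → contradiction (∈N⁻ e∈N⊥) ∉⊥) , rank-mono M ⊥⊆
    ; budget-needs-rank      = λ Z _ marginal≡0 → Empty⇒∣p∣≡0 (no-budget Z marginal≡0)
    }
    where
    no-budget : ∀ Z → marginal ⊥ Z ≡ 0 → Empty (Z ∩ A)
    no-budget Z marginal≡0 (i , i∈Z∩A) = contradiction (begin
      1                 ≤⟨ nondegenerate i (proj₂ (x∈p∩q⁻ Z A i∈Z∩A)) ⟩
      rankN ⁅ i ⁆       ≤⟨ rankN-mono (x∈p⇒⁅x⁆⊆p (q⊆p∪q ⊥ Z (proj₁ (x∈p∩q⁻ Z A i∈Z∩A)))) ⟩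
      rankN (⊥ ∪ Z)     ≤⟨ ℕₚ.m∸n≡0⇒m≤n marginal≡0 ⟩
      rankN ⊥           ≡⟨ rankN-Empty (λ (_ , i∈⊥) → ∉⊥ i∈⊥) ⟩
      0                 ∎) λ ()
      where open ℕₚ.≤-Reasoning

  module _ (nondegenerate : ∀ i → i ∈ A → 1 ≤ rank M (P i)) (canonical : Canonical A p) where

    levelSet-canonical : ∀ {l} → 0ℚ < l → LevelSet l ⊥
    levelSet-canonical 0<l = levelSet 0<l (initial-invariant nondegenerate)
      (inj₂ ((λ (_ , i∈⊥) → ∉⊥ i∈⊥) , (λ (_ , e∈⊥) → ∉⊥ e∈⊥))) (λ _ e∈⊥ → contradiction e∈⊥ ∉⊥) canonical

    prices-nonNeg-canonical : ∀ e → 0ℚ ≤ℚ p e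
    prices-nonNeg-canonical e = prices-nonNeg (initial-invariant nondegenerate) canonical e ∉⊥

-- Arrival of a buyer

module Arrival {n k : ℕ} (M : Matroid n) (owner : Fin n → Fin k) (A : Subset k) (iinc : Fin k) (iinc∉A : iinc ∉ A)
  (nondegenerate : ∀ i → i ∈ A ∪ ⁅ iinc ⁆ → 1 ≤ rank M (Market.P M owner i))
  (pold pnew : Fin n → ℚ)
  (canonical-old : Market.Canonical M owner A pold)
  (canonical-new : Market.Canonical M owner (A ∪ ⁅ iinc ⁆) pnew) where

  open Market M owner using (N)
  open Rank M
  open Buyers M owner
  module Old = Skeleton M owner A pold
  module New = Skeleton M owner (A ∪ ⁅ iinc ⁆) pnew

  nondegenerate-old : ∀ i → i ∈ A → 1 ≤ rank M (Market.P M owner i)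
  nondegenerate-old i i∈A = nondegenerate i (p⊆p∪q ⁅ iinc ⁆ i∈A)

  ⁅iinc⁆∩A≡∅ : Empty (⁅ iinc ⁆ ∩ A)
  ⁅iinc⁆∩A≡∅ (i , i∈) = let (i∈⁅iinc⁆ , i∈A) = x∈p∩q⁻ ⁅ iinc ⁆ A i∈
                        in iinc∉A (subst (_∈ A) (x∈⁅y⁆⇒x≡y iinc i∈⁅iinc⁆) i∈A)

  budget-arrival : ∀ Y → New.budget Y ≡ Old.budget Y + ∣ Y ∩ ⁅ iinc ⁆ ∣
  budget-arrival Y = trans (cong ∣_∣ (∩-distribˡ-∪ Y A ⁅ iinc ⁆)) (∣p∪q∣≡∣p∣+∣q∣ (Y ∩ A) (Y ∩ ⁅ iinc ⁆) disjoint)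
    where
    disjoint : Empty ((Y ∩ A) ∩ (Y ∩ ⁅ iinc ⁆))
    disjoint (i , i∈) = let (i∈Y∩A , i∈Y∩⁅iinc⁆) = x∈p∩q⁻ (Y ∩ A) (Y ∩ ⁅ iinc ⁆) i∈
      in ⁅iinc⁆∩A≡∅ (i , x∈p∩q⁺ (proj₂ (x∈p∩q⁻ Y ⁅ iinc ⁆ i∈Y∩⁅iinc⁆) , proj₂ (x∈p∩q⁻ Y A i∈Y∩A)))

  surplus-arrival : ∀ l Y → New.surplus l Y ≡ Old.surplus l Y ℚ.+ fromℕ ∣ Y ∩ ⁅ iinc ⁆ ∣
  surplus-arrival l Y =
    trans (cong (λ a → excess l a (rankN Y)) (budget-arrival Y))
          (excess-+ˡ l (Old.budget Y) ∣ Y ∩ ⁅ iinc ⁆ ∣ (rankN Y))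

  ∣Y∩⁅iinc⁆∣≤1 : ∀ Y → ∣ Y ∩ ⁅ iinc ⁆ ∣ ≤ 1
  ∣Y∩⁅iinc⁆∣≤1 Y = ℕₚ.≤-trans (p⊆q⇒∣p∣≤∣q∣ (p∩q⊆q Y ⁅ iinc ⁆)) (ℕₚ.≤-reflexive (∣⁅x⁆∣≡1 iinc))

  module AtLevel {l : ℚ} (0<l : 0ℚ < l) where
    module Before = Old.LevelSet (Old.levelSet-canonical nondegenerate-old canonical-old 0<l)
    module After  = New.LevelSet (New.levelSet-canonical nondegenerate canonical-new 0<l)

    Cb = Before.buyers
    Ca = After.buyers

    -- Supermodularity and the maximality of Cb make Ca ∪ Cb at least as good as Ca for the old
    -- surplus, and the arrival term is monotone, so Ca ∪ Cb also maximises the new surplus.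
    rankN-∪-≤-after : rankN (Cb ∪ Ca) ≤ rankN Ca
    rankN-∪-≤-after = ℕₚ.≤-trans (rankN-mono (∪-⊆ (⊆-trans (q⊆p∪q Ca Cb) (p⊆p∪q Ca)) (q⊆p∪q U Ca)))
      (After.rank-maximal U ⊥⊆ (ℚₚ.≤-antisym (After.surplus-maximal U ⊥⊆) new-Ca≤new-U))
      where
      U = Ca ∪ Cb
      old-Ca≤old-U : Old.surplus l Ca ≤ℚ Old.surplus l U
      old-Ca≤old-U = p+q≤r+s∧s≤q⇒p≤r (Old.surplus-supermodular (ℚₚ.<⇒≤ 0<l) Ca Cb)
                                       (Before.surplus-maximal (Ca ∩ Cb) ⊥⊆)
      new-Ca≤new-U : New.surplus l Ca ≤ℚ New.surplus l U
      new-Ca≤new-U = subst₂ _≤ℚ_ (sym (surplus-arrival l Ca)) (sym (surplus-arrival l U))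
        (ℚₚ.+-mono-≤ old-Ca≤old-U (fromℕ-mono-≤ (p⊆q⇒∣p∣≤∣q∣ (∩-monoˡ-⊆ ⁅ iinc ⁆ (p⊆p∪q {p = Ca} Cb)))))

    -- Adding iinc to Cb keeps its rank and raises the new surplus by exactly one, while the
    -- arrival term is at most one, so Ca maximises the old surplus.
    rankN-∪-≤-before : N ⁅ iinc ⁆ ⊆ Before.elements → rankN (Ca ∪ Cb) ≤ rankN Cb
    rankN-∪-≤-before P-iinc⊆Eb =
      Before.rank-maximal Ca ⊥⊆ (ℚₚ.≤-antisym (Before.surplus-maximal Ca ⊥⊆) old-Cb≤old-Ca)
      where
      Cb+ = Cb ∪ ⁅ iinc ⁆

      old-Cb+≡old-Cb : Old.surplus l Cb+ ≡ Old.surplus l Cb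
      old-Cb+≡old-Cb = cong₂ (excess l) budget≡ rankN≡
        where
        budget≡ : Old.budget Cb+ ≡ Old.budget Cb
        budget≡ = cong ∣_∣ (begin
          Cb+ ∩ A                     ≡⟨ ∩-distribʳ-∪ A Cb ⁅ iinc ⁆ ⟩
          (Cb ∩ A) ∪ (⁅ iinc ⁆ ∩ A)   ≡⟨ cong ((Cb ∩ A) ∪_) (Empty-unique ⁅iinc⁆∩A≡∅) ⟩
          (Cb ∩ A) ∪ ⊥                ≡⟨ ∪-identityʳ (Cb ∩ A) ⟩
          Cb ∩ A                      ∎)
          where open ≡-Reasoning
        rankN≡ : rankN Cb+ ≡ rankN Cb
        rankN≡ = ℕₚ.≤-antisym
          (ℕₚ.≤-trans (rank-mono M (subst (_⊆ Before.elements) (sym (N-∪ Cb ⁅ iinc ⁆))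
                                          (∪-⊆ (proj₁ Before.N-spans) P-iinc⊆Eb)))
                      (proj₂ Before.N-spans))
          (rankN-mono (p⊆p∪q {p = Cb} ⁅ iinc ⁆))

      ∣Cb+∩⁅iinc⁆∣≡1 : ∣ Cb+ ∩ ⁅ iinc ⁆ ∣ ≡ 1
      ∣Cb+∩⁅iinc⁆∣≡1 = ℕₚ.≤-antisym (∣Y∩⁅iinc⁆∣≤1 Cb+)
        (subst (_≤ ∣ Cb+ ∩ ⁅ iinc ⁆ ∣) (∣⁅x⁆∣≡1 iinc) (p⊆q⇒∣p∣≤∣q∣ (λ i∈ → x∈p∩q⁺ (q⊆p∪q Cb ⁅ iinc ⁆ i∈ , i∈))))

      old-Cb≤old-Ca : Old.surplus l Cb ≤ℚ Old.surplus l Ca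
      old-Cb≤old-Ca = +-cancelʳ-≤ (fromℕ 1) (begin
        Old.surplus l Cb ℚ.+ fromℕ 1                   ≡⟨ cong₂ ℚ._+_ old-Cb+≡old-Cb (cong fromℕ ∣Cb+∩⁅iinc⁆∣≡1) ⟨
        Old.surplus l Cb+ ℚ.+ fromℕ ∣ Cb+ ∩ ⁅ iinc ⁆ ∣ ≡⟨ surplus-arrival l Cb+ ⟨
        New.surplus l Cb+                              ≤⟨ After.surplus-maximal Cb+ ⊥⊆ ⟩
        New.surplus l Ca                               ≡⟨ surplus-arrival l Ca ⟩
        Old.surplus l Ca ℚ.+ fromℕ ∣ Ca ∩ ⁅ iinc ⁆ ∣   ≤⟨ ℚₚ.+-monoʳ-≤ (Old.surplus l Ca) (fromℕ-mono-≤ (∣Y∩⁅iinc⁆∣≤1 Ca)) ⟩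
        Old.surplus l Ca ℚ.+ fromℕ 1                   ∎)
        where open ℚₚ.≤-Reasoning

    before⊆after : Before.elements ⊆ After.elements
    before⊆after with After.flat-or-empty | Before.flat-or-empty
    ... | inj₁ (flat , _) | _ = ⊆-Flat flat Before.N-spans After.N-spans
      (subst (λ Y → rank M Y ≤ rankN Ca) (N-∪ Cb Ca) rankN-∪-≤-after)
    ... | inj₂ _ | inj₂ (_ , Eb≡∅) = λ e∈Eb → contradiction (_ , e∈Eb) Eb≡∅
    ... | inj₂ (Ca≡∅ , _) | inj₁ (_ , 1≤rankN-Cb) = contradiction (begin
      1                ≤⟨ 1≤rankN-Cb ⟩
      rankN Cb         ≤⟨ rankN-mono (p⊆p∪q {p = Cb} Ca) ⟩
      rankN (Cb ∪ Ca)  ≤⟨ rankN-∪-≤-after ⟩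
      rankN Ca         ≡⟨ rankN-Empty Ca≡∅ ⟩
      0                ∎) λ ()
      where open ℕₚ.≤-Reasoning

    after⊆before : N ⁅ iinc ⁆ ⊆ Before.elements → After.elements ⊆ Before.elements
    after⊆before P-iinc⊆Eb with Before.flat-or-empty
    ... | inj₁ (flat , _) = ⊆-Flat flat After.N-spans Before.N-spans
      (subst (λ Y → rank M Y ≤ rankN Cb) (N-∪ Ca Cb) (rankN-∪-≤-before P-iinc⊆Eb))
    ... | inj₂ (_ , Eb≡∅) = contradiction (begin
      1                    ≤⟨ nondegenerate iinc (q⊆p∪q A ⁅ iinc ⁆ (x∈⁅x⁆ iinc)) ⟩
      rank M (N ⁅ iinc ⁆)  ≡⟨ rank-Empty (λ (e , e∈) → Eb≡∅ (e , P-iinc⊆Eb e∈)) ⟩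
      0                    ∎) λ ()
      where open ℕₚ.≤-Reasoning

  prices-monotone : ∀ e → pold e ≤ℚ pnew e
  prices-monotone e with pold e ℚₚ.≤? 0ℚ
  ... | yes pold≤0 = ℚₚ.≤-trans pold≤0 (New.prices-nonNeg-canonical nondegenerate canonical-new e)
  ... | no  pold≰0 = After.∈⇒≥l e (before⊆after (Before.≥l⇒∈ e ℚₚ.≤-refl))
    where open AtLevel (ℚₚ.≰⇒> pold≰0)

  prices-unchanged-below : ∀ q → (∀ e → owner e ≡ iinc → q ≤ℚ pold e) → ∀ e → pold e < q → pnew e ≡ pold e
  prices-unchanged-below q q≤P-iinc e pold<q with pold e ℚₚ.<? pnew e
  ... | no  pold≮pnew = ℚₚ.≤-antisym (ℚₚ.≮⇒≥ pold≮pnew) (prices-monotone e)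
  ... | yes pold<pnew with <-dense-≤ pold<q pold<pnew
  ...   | μ , pold<μ , μ<q , μ≤pnew = contradiction μ≤pold (<⇒≱ pold<μ)
    where
    open AtLevel (ℚₚ.≤-<-trans (Old.prices-nonNeg-canonical nondegenerate-old canonical-old e) pold<μ)
    P-iinc⊆Eb : N ⁅ iinc ⁆ ⊆ Before.elements
    P-iinc⊆Eb {x} x∈ = Before.≥l⇒∈ x (ℚₚ.≤-trans (ℚₚ.<⇒≤ μ<q) (q≤P-iinc x (x∈⁅y⁆⇒x≡y iinc (∈N⁻ x∈))))
    μ≤pold : μ ≤ℚ pold e
    μ≤pold = Before.∈⇒≥l e (after⊆before P-iinc⊆Eb (After.≥l⇒∈ e μ≤pnew))

mainTheorem9 : ∀ {n k : ℕ} (M : Matroid n) (owner : Fin n → Fin k)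
    (A : Subset k) (iinc : Fin k) → iinc ∉ A →
    (∀ i → i ∈ (A ∪ ⁅ iinc ⁆) → 1 ≤ rank M (Market.P M owner i)) →
    (pold pnew : Fin n → ℚ) →
    Market.Canonical M owner A pold →
    Market.Canonical M owner (A ∪ ⁅ iinc ⁆) pnew →
    (∀ e → pold e ≤ℚ pnew e) ×
    ((q : ℚ) →
      (∃ λ e → owner e ≡ iinc × pold e ≡ q) →
      (∀ e → owner e ≡ iinc → q ≤ℚ pold e) →
      ∀ e → pold e < q → pnew e ≡ pold e)
mainTheorem9 M owner A iinc iinc∉A nondegenerate pold pnew canonical-old canonical-new =
  prices-monotone , λ q _ q≤P-iinc → prices-unchanged-below q q≤P-iinc
  where open Arrival M owner A iinc iinc∉A nondegenerate pold pnew canonical-old canonical-new
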